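{- Let $V$ be a finite set of nails and let $T$ be a commutator tree (a binary tree each of whose internal nodes is the commutator $[A,B]$ of the expressions $A,B$ at its two children) whose leaves are expressions in the variables of $V$ solving specifications $g_1,\dots,g_m$ on $V$, respectively. Let $f = g_1 \vee \cdots \vee g_m$. Then $T$ solves $f$ if and only if there is no internal node $N$ of $T$ and no $S \subseteq V$ with $f(S) = \mathsf{hang}$ such that the expression at $N$ satisfies $N|_S = 0$. In particular, $T$ solves $f$ if, for every $S \subseteq V$ with $f(S) = \mathsf{hang}$ and every internal node of $T$, the specifications solved by the expressions at the two children of that node separate above $S$.
   Context: Expressions are elements of the free group on the variables (nails) of $V$, written additively: $+$ is the non-commutative group operation, $-x$ the inverse, $0$ the identity. The commutator is $[a,b] = a + b - a - b$. For $S \subseteq V$, $h|_S$ denotes $h$ with every variable in $S$ set to $0$. A specification on $V$ is a monotone function $f : 2^V \to \{\mathsf{hang},\mathsf{fall}\}$ (order $\mathsf{hang} < \mathsf{fall}$; monotone means $S \subseteq S' \Rightarrow f(S) \le f(S')$) with $f(V) = \mathsf{fall}$. An expression $h$ solves $f$ if for every $S \subseteq V$: $h|_S = 0 \iff f(S) = \mathsf{fall}$; every expression $h$ on $V$ solves exactly one specification, namely $S \mapsto \mathsf{fall}$ iff $h|_S = 0$. $\vee$ is pointwise max. Two specifications $g_1,g_2$ separate above $S$ if there exists $S' \supseteq S$ with $g_1(S') \neq g_2(S')$. -}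

module Defs where

open import Data.Nat using (ℕ)
open import Data.Bool using (Bool; true; false; not; _∧_)
open import Data.Fin using (Fin)
open import Data.Fin.Properties using () renaming (_≟_ to _≟ᶠ_)
open import Data.Fin.Subset using (Subset; ⊤; _⊆_)
open import Data.Vec using (lookup)
open import Data.List using (List; []; _∷_; _++_; reverse; map; foldr; filterᵇ)
open import Data.Product using (_×_; _,_; ∃; Σ-syntax)
open import Relation.Nullary using (¬_; does)
open import Relation.Binary.PropositionalEquality using (_≡_)

-- An expression is a word of letters (x , b): b = true means +x,
-- b = false means -x. Words are interpreted in the free group; two words
-- denote the same element iff their free reductions coincide.

Letter : ℕ → Set
Letter n = Fin n × Bool

Expr : ℕ → Set
Expr n = List (Letter n)

0ₑ : ∀ {n} → Expr n
0ₑ = []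

_+ₑ_ : ∀ {n} → Expr n → Expr n → Expr n
a +ₑ b = a ++ b

-ₑ_ : ∀ {n} → Expr n → Expr n
-ₑ a = reverse (map (λ { (x , b) → (x , not b) }) a)

⟦_,_⟧ : ∀ {n} → Expr n → Expr n → Expr n
⟦ a , b ⟧ = a +ₑ (b +ₑ ((-ₑ a) +ₑ (-ₑ b)))

cancels : ∀ {n} → Letter n → Letter n → Bool
cancels (x , b) (y , c) = does (x ≟ᶠ y) ∧ not (eqB b c)
  where
  eqB : Bool → Bool → Bool
  eqB true true = true
  eqB false false = true
  eqB _ _ = false

push : ∀ {n} → Letter n → Expr n → Expr n
push l [] = l ∷ []
push l (l' ∷ w) with cancels l l'
... | true  = w
... | false = l ∷ l' ∷ w

reduce : ∀ {n} → Expr n → Expr n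
reduce = foldr push []

IsZero : ∀ {n} → Expr n → Set
IsZero h = reduce h ≡ []

-- h|_S : every variable in S set to 0
_∣_ : ∀ {n} → Expr n → Subset n → Expr n
h ∣ S = filterᵇ (λ { (x , _) → not (lookup S x) }) h

data Outcome : Set where
  hang fall : Outcome

data _≤ₒ_ : Outcome → Outcome → Set where
  hang≤ : ∀ {o} → hang ≤ₒ o
  fall≤fall : fall ≤ₒ fall

_⊔ₒ_ : Outcome → Outcome → Outcome
hang ⊔ₒ o = o
fall ⊔ₒ _ = fall

record Spec (n : ℕ) : Set where
  field
    fn   : Subset n → Outcome
    mono : ∀ {S S'} → S ⊆ S' → fn S ≤ₒ fn S'
    top  : fn ⊤ ≡ fall
open Spec public

Solves : ∀ {n} → Expr n → (Subset n → Outcome) → Set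
Solves h f = ∀ S → (IsZero (h ∣ S) → f S ≡ fall) × (f S ≡ fall → IsZero (h ∣ S))

specOf : ∀ {n} → Expr n → Subset n → Outcome
specOf h S with reduce (h ∣ S)
... | []    = fall
... | _ ∷ _ = hang

⋁ : ∀ {n} → List (Spec n) → Subset n → Outcome
⋁ gs S = foldr (λ g o → fn g S ⊔ₒ o) hang gs

SeparateAbove : ∀ {n} → (Subset n → Outcome) → (Subset n → Outcome) → Subset n → Set
SeparateAbove g₁ g₂ S = ∃ λ S' → S ⊆ S' × ¬ (g₁ S' ≡ g₂ S')

data CTree (n : ℕ) : Set where
  leaf : Expr n → CTree n
  node : CTree n → CTree n → CTree n

expr : ∀ {n} → CTree n → Expr n
expr (leaf h)   = h
expr (node l r) = ⟦ expr l , expr r ⟧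

leaves : ∀ {n} → CTree n → List (Expr n)
leaves (leaf h)   = h ∷ []
leaves (node l r) = leaves l ++ leaves r

internals : ∀ {n} → CTree n → List (CTree n × CTree n)
internals (leaf _)   = []
internals (node l r) = (l , r) ∷ (internals l ++ internals r)

-- A commutator vanishes under a deletion of variables as soon as one of its entries does, and deletions are
-- endomorphisms of the free group; this gives all implications except the separation criterion. For that,
-- suppose the node [A, B] vanishes under a hang set S while A|S and B|S do not. Then A|S and B|S commute, and
-- in a free group the centraliser of x ≠ 0 is cyclic, generated by some r of which x is a nonzero multiple.
-- Free groups are torsion-free, so every deletion S' ⊇ S killing A|S kills r and hence B|S, and symmetrically:
-- A and B solve the same specification above S.
module Submission where

open import Defs
open import Algebra.Bundles using (Group)
import Algebra.Properties.Monoid.Mult as Mult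
open import Data.Bool using (true; false; not)
open import Data.Bool.Properties using (not-involutive)
open import Data.Empty using (⊥; ⊥-elim)
open import Data.Fin.Properties using () renaming (_≟_ to _≟ᶠ_)
open import Data.Fin.Subset using (Subset; _⊆_)
open import Data.List using (List; []; _∷_; _++_; [_]; _∷ʳ_; _∷ʳ′_; initLast; reverse; map; foldr; length)
open import Data.List.Membership.Propositional using (_∈_)
open import Data.List.Properties
  using ( ++-assoc; ++-identityʳ; ++-monoid; ∷-injective; ∷-injectiveˡ; ∷ʳ-injective; foldr-++; filter-++
        ; length-++; length-map; length-reverse; map-++; reverse-++; unfold-reverse )
open import Data.List.Relation.Binary.Pointwise using (Pointwise; []; _∷_)
open import Data.List.Relation.Unary.Any using (Any; here; there)
open import Data.List.Relation.Unary.Any.Properties using (++⁺ˡ; ++⁺ʳ; ++⁻)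
open import Data.Nat using (ℕ; zero; suc; _+_; _*_; _≤_; _<_; z≤n; s≤s)
open import Data.Nat.Induction using (<-wellFounded)
open import Data.Nat.Properties
  using (≤-total; +-comm; +-suc; +-cancelˡ-≡; *-cancelˡ-≡; m≤m+n; m<m+n; m<n+m; m≢1+m+n)
open import Data.Nat.Tactic.RingSolver using (solve-∀)
open import Data.Product using (_×_; _,_; proj₁; proj₂; ∃; ∃-syntax)
open import Data.Sum as Sum using (_⊎_; inj₁; inj₂)
open import Data.Vec using (lookup)
open import Data.Vec.Properties using (lookup⇒[]=; []=⇒lookup)
open import Function using (_∘_)
open import Induction.WellFounded using (Acc; acc)
open import Level using (0ℓ)
open import Relation.Binary.Bundles using (Setoid)
open import Relation.Binary.PropositionalEquality
  using (_≡_; _≢_; refl; sym; trans; cong; cong₂; subst; module ≡-Reasoning)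
import Relation.Binary.Reasoning.Setoid as SetoidReasoning
open import Relation.Binary.Structures using (IsEquivalence)
open import Relation.Nullary using (¬_; yes; no; contradiction)

private variable
  n : ℕ

module Commutators {g ℓ} (G : Group g ℓ) where
  open Group G hiding (refl; sym; trans)
  open import Algebra.Properties.Group G
    using (ε⁻¹≈ε; x∙y⁻¹≈ε⇒x≈y; ⁻¹-anti-homo-∙; inverseʳ-unique; ⁻¹-involutive; identityˡ-unique)
  open SetoidReasoning setoid

  ⁅_,_⁆ : Carrier → Carrier → Carrier
  ⁅ a , b ⁆ = a ∙ (b ∙ (a ⁻¹ ∙ b ⁻¹))

  conj : Carrier → Carrier → Carrier
  conj u x = u ⁻¹ ∙ (x ∙ u)

  ⁅⁆-zeroˡ : ∀ {a} b → a ≈ ε → ⁅ a , b ⁆ ≈ ε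
  ⁅⁆-zeroˡ {a} b a≈ε = begin
    a ∙ (b ∙ (a ⁻¹ ∙ b ⁻¹))  ≈⟨ ∙-cong a≈ε (∙-congˡ (∙-congʳ (⁻¹-cong a≈ε))) ⟩
    ε ∙ (b ∙ (ε ⁻¹ ∙ b ⁻¹))  ≈⟨ identityˡ _ ⟩
    b ∙ (ε ⁻¹ ∙ b ⁻¹)        ≈⟨ ∙-congˡ (∙-congʳ ε⁻¹≈ε) ⟩
    b ∙ (ε ∙ b ⁻¹)           ≈⟨ ∙-congˡ (identityˡ _) ⟩
    b ∙ b ⁻¹                 ≈⟨ inverseʳ b ⟩
    ε                        ∎

  ⁅⁆-zeroʳ : ∀ a {b} → b ≈ ε → ⁅ a , b ⁆ ≈ ε
  ⁅⁆-zeroʳ a {b} b≈ε = begin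
    a ∙ (b ∙ (a ⁻¹ ∙ b ⁻¹))  ≈⟨ ∙-congˡ (∙-cong b≈ε (∙-congˡ (⁻¹-cong b≈ε))) ⟩
    a ∙ (ε ∙ (a ⁻¹ ∙ ε ⁻¹))  ≈⟨ ∙-congˡ (identityˡ _) ⟩
    a ∙ (a ⁻¹ ∙ ε ⁻¹)        ≈⟨ ∙-congˡ (∙-congˡ ε⁻¹≈ε) ⟩
    a ∙ (a ⁻¹ ∙ ε)           ≈⟨ ∙-congˡ (identityʳ _) ⟩
    a ∙ a ⁻¹                 ≈⟨ inverseʳ a ⟩
    ε                        ∎

  ⁅⁆≈ε⇒comm : ∀ a b → ⁅ a , b ⁆ ≈ ε → a ∙ b ≈ b ∙ a
  ⁅⁆≈ε⇒comm a b ⁅a,b⁆≈ε = x∙y⁻¹≈ε⇒x≈y (a ∙ b) (b ∙ a) (begin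
    (a ∙ b) ∙ (b ∙ a) ⁻¹      ≈⟨ ∙-congˡ (⁻¹-anti-homo-∙ b a) ⟩
    (a ∙ b) ∙ (a ⁻¹ ∙ b ⁻¹)   ≈⟨ assoc a b _ ⟩
    ⁅ a , b ⁆                 ≈⟨ ⁅a,b⁆≈ε ⟩
    ε                         ∎)

  conj-homo : ∀ u x y → conj u (x ∙ y) ≈ conj u x ∙ conj u y
  conj-homo u x y = begin
    u ⁻¹ ∙ ((x ∙ y) ∙ u)                 ≈⟨ ∙-congˡ (assoc _ _ _) ⟩
    u ⁻¹ ∙ (x ∙ (y ∙ u))                 ≈⟨ ∙-congˡ (∙-congˡ (identityˡ _)) ⟨
    u ⁻¹ ∙ (x ∙ (ε ∙ (y ∙ u)))           ≈⟨ ∙-congˡ (∙-congˡ (∙-congʳ (inverseʳ u))) ⟨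
    u ⁻¹ ∙ (x ∙ ((u ∙ u ⁻¹) ∙ (y ∙ u)))  ≈⟨ ∙-congˡ (∙-congˡ (assoc _ _ _)) ⟩
    u ⁻¹ ∙ (x ∙ (u ∙ (u ⁻¹ ∙ (y ∙ u))))  ≈⟨ ∙-congˡ (assoc _ _ _) ⟨
    u ⁻¹ ∙ ((x ∙ u) ∙ (u ⁻¹ ∙ (y ∙ u)))  ≈⟨ assoc _ _ _ ⟨
    (u ⁻¹ ∙ (x ∙ u)) ∙ (u ⁻¹ ∙ (y ∙ u))  ∎

  conj-cong : ∀ u {x y} → x ≈ y → conj u x ≈ conj u y
  conj-cong u x≈y = ∙-congˡ (∙-congʳ x≈y)

  conj-comm : ∀ u {x y} → x ∙ y ≈ y ∙ x → conj u x ∙ conj u y ≈ conj u y ∙ conj u x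
  conj-comm u {x} {y} xy≈yx = begin
    conj u x ∙ conj u y  ≈⟨ conj-homo u x y ⟨
    conj u (x ∙ y)       ≈⟨ conj-cong u xy≈yx ⟩
    conj u (y ∙ x)       ≈⟨ conj-homo u y x ⟩
    conj u y ∙ conj u x  ∎

  conj≈ε⇒≈ε : ∀ u x → conj u x ≈ ε → x ≈ ε
  conj≈ε⇒≈ε u x conj≈ε = identityˡ-unique x u (begin
    x ∙ u          ≈⟨ inverseʳ-unique (u ⁻¹) (x ∙ u) conj≈ε ⟩
    u ⁻¹ ⁻¹        ≈⟨ ⁻¹-involutive u ⟩
    u              ∎)

  conj-cancel : ∀ u x → conj u (u ∙ (x ∙ u ⁻¹)) ≈ x
  conj-cancel u x = begin
    u ⁻¹ ∙ ((u ∙ (x ∙ u ⁻¹)) ∙ u)  ≈⟨ assoc _ _ _ ⟨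
    (u ⁻¹ ∙ (u ∙ (x ∙ u ⁻¹))) ∙ u  ≈⟨ ∙-congʳ (assoc _ _ _) ⟨
    ((u ⁻¹ ∙ u) ∙ (x ∙ u ⁻¹)) ∙ u  ≈⟨ ∙-congʳ (∙-congʳ (inverseˡ u)) ⟩
    (ε ∙ (x ∙ u ⁻¹)) ∙ u           ≈⟨ ∙-congʳ (identityˡ _) ⟩
    (x ∙ u ⁻¹) ∙ u                 ≈⟨ assoc _ _ _ ⟩
    x ∙ (u ⁻¹ ∙ u)                 ≈⟨ ∙-congˡ (inverseˡ u) ⟩
    x ∙ ε                          ≈⟨ identityʳ x ⟩
    x                              ∎

  ≈ε⇒conj≈ε : ∀ u {x} → x ≈ ε → conj u x ≈ ε
  ≈ε⇒conj≈ε u {x} x≈ε = begin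
    u ⁻¹ ∙ (x ∙ u)  ≈⟨ ∙-congˡ (∙-congʳ x≈ε) ⟩
    u ⁻¹ ∙ (ε ∙ u)  ≈⟨ ∙-congˡ (identityˡ u) ⟩
    u ⁻¹ ∙ u        ≈⟨ inverseˡ u ⟩
    ε               ∎

module Multiples {a} {A : Set a} = Mult (++-monoid A)
open Multiples using () renaming (_×_ to _·_; ×-homo-+ to ·-homo-+)

module _ {a} {A : Set a} where

  ++-≡⇒prefix : (xs ys us vs : List A) → xs ++ ys ≡ us ++ vs → length xs ≤ length us →
                ∃[ ms ] us ≡ xs ++ ms × ys ≡ ms ++ vs
  ++-≡⇒prefix []       ys us       vs eq _         = us , refl , eq
  ++-≡⇒prefix (x ∷ xs) ys (u ∷ us) vs eq (s≤s xs≤us) with refl , eq′ ← ∷-injective eq =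
    let ms , us≡ , ys≡ = ++-≡⇒prefix xs ys us vs eq′ xs≤us in ms , cong (x ∷_) us≡ , ys≡

  record CommonRoot (xs ys : List A) : Set a where
    field
      root : List A
      i j  : ℕ
      xs≡  : xs ≡ i · root
      ys≡  : ys ≡ j · root

  CommonRoot-swap : ∀ {xs ys} → CommonRoot xs ys → CommonRoot ys xs
  CommonRoot-swap r = record { root = root ; i = j ; j = i ; xs≡ = ys≡ ; ys≡ = xs≡ }
    where open CommonRoot r

  CommonRoot-extend : ∀ {xs ms ys} → CommonRoot xs ms → ys ≡ xs ++ ms → CommonRoot xs ys
  CommonRoot-extend {xs} {ms} r ys≡xs++ms = record
    { root = root ; i = i ; j = i + j ; xs≡ = xs≡
    ; ys≡ = trans ys≡xs++ms (trans (cong₂ _++_ xs≡ ys≡) (sym (·-homo-+ root i j)))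
    }
    where open CommonRoot r

  ++-comm⇒commonRoot′ : ∀ xs ys → Acc _<_ (length xs + length ys) → xs ++ ys ≡ ys ++ xs → CommonRoot xs ys
  ++-comm⇒commonRoot′ [] ys _ _ = record { root = ys ; i = 0 ; j = 1 ; xs≡ = refl ; ys≡ = sym (++-identityʳ ys) }
  ++-comm⇒commonRoot′ xs@(_ ∷ _) [] _ _ = record { root = xs ; i = 1 ; j = 0 ; xs≡ = sym (++-identityʳ xs) ; ys≡ = refl }
  ++-comm⇒commonRoot′ xs@(_ ∷ _) ys@(_ ∷ _) (acc rs) comm with ≤-total (length xs) (length ys)
  ... | inj₁ xs≤ys =
    let ms , ys≡xs++ms , ys≡ms++xs = ++-≡⇒prefix xs ys ys xs comm xs≤ys
        |ys|≡ = trans (cong length ys≡xs++ms) (length-++ xs)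
    in CommonRoot-extend
         (++-comm⇒commonRoot′ xs ms (rs (subst (_< length xs + length ys) |ys|≡ (m<n+m (length ys) (s≤s z≤n))))
                                    (trans (sym ys≡xs++ms) ys≡ms++xs))
         ys≡xs++ms
  ... | inj₂ ys≤xs =
    let ms , xs≡ys++ms , xs≡ms++ys = ++-≡⇒prefix ys xs xs ys (sym comm) ys≤xs
        |xs|≡ = trans (cong length xs≡ys++ms) (length-++ ys)
    in CommonRoot-swap (CommonRoot-extend
         (++-comm⇒commonRoot′ ys ms (rs (subst (_< length xs + length ys) |xs|≡ (m<m+n (length xs) (s≤s z≤n))))
                                    (trans (sym xs≡ys++ms) xs≡ms++ys))
         xs≡ys++ms)

  ++-comm⇒commonRoot : ∀ xs ys → xs ++ ys ≡ ys ++ xs → CommonRoot xs ys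
  ++-comm⇒commonRoot xs ys = ++-comm⇒commonRoot′ xs ys (<-wellFounded _)

-ₗ_ : Letter n → Letter n
-ₗ (x , b) = x , not b

-ₗ-involutive : (l : Letter n) → -ₗ -ₗ l ≡ l
-ₗ-involutive (x , b) = cong (x ,_) (not-involutive b)

cancels⇒≡-ₗ : (l l' : Letter n) → cancels l l' ≡ true → l' ≡ -ₗ l
cancels⇒≡-ₗ (x , b) (y , c) eq with x ≟ᶠ y
cancels⇒≡-ₗ (x , true)  (.x , false) eq | yes refl = refl
cancels⇒≡-ₗ (x , false) (.x , true)  eq | yes refl = refl

cancels-ₗ : (l : Letter n) → cancels l (-ₗ l) ≡ true
cancels-ₗ (x , b) with x ≟ᶠ x
... | no x≢x = contradiction refl x≢x
cancels-ₗ (x , true)  | yes refl = refl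
cancels-ₗ (x , false) | yes refl = refl

cancels-ₗˡ : (l : Letter n) → cancels (-ₗ l) l ≡ true
cancels-ₗˡ l = subst (λ l' → cancels (-ₗ l) l' ≡ true) (-ₗ-involutive l) (cancels-ₗ (-ₗ l))

cancels-self : (l : Letter n) → cancels l l ≡ false
cancels-self (x , b) with x ≟ᶠ x
... | no _ = refl
cancels-self (x , true)  | yes refl = refl
cancels-self (x , false) | yes refl = refl

-ₑ-∷ : (l : Letter n) (a : Expr n) → -ₑ (l ∷ a) ≡ -ₑ a ++ [ -ₗ l ]
-ₑ-∷ l a = unfold-reverse (-ₗ l) (map -ₗ_ a)

-ₑ-++ : (a b : Expr n) → -ₑ (a ++ b) ≡ -ₑ b ++ -ₑ a
-ₑ-++ a b = trans (cong reverse (map-++ -ₗ_ a b)) (reverse-++ (map -ₗ_ a) (map -ₗ_ b))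

-ₑ-involutive : (a : Expr n) → -ₑ -ₑ a ≡ a
-ₑ-involutive []      = refl
-ₑ-involutive (l ∷ a) = begin
  -ₑ -ₑ (l ∷ a)            ≡⟨ cong -ₑ_ (-ₑ-∷ l a) ⟩
  -ₑ (-ₑ a ++ [ -ₗ l ])    ≡⟨ -ₑ-++ (-ₑ a) [ -ₗ l ] ⟩
  [ -ₗ -ₗ l ] ++ -ₑ -ₑ a   ≡⟨ cong₂ _∷_ (-ₗ-involutive l) (-ₑ-involutive a) ⟩
  l ∷ a                    ∎
  where open ≡-Reasoning

length--ₑ : (a : Expr n) → length (-ₑ a) ≡ length a
length--ₑ a = trans (length-reverse (map -ₗ_ a)) (length-map -ₗ_ a)

data Reduced {n : ℕ} : Expr n → Set where
  red-[]  : Reduced []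
  red-[_] : ∀ l → Reduced [ l ]
  red-∷   : ∀ {l l' w} → cancels l l' ≡ false → Reduced (l' ∷ w) → Reduced (l ∷ l' ∷ w)

Reduced-tail : ∀ {l : Letter n} {w} → Reduced (l ∷ w) → Reduced w
Reduced-tail red-[ _ ]    = red-[]
Reduced-tail (red-∷ _ r)  = r

Reduced-head : ∀ {l l' : Letter n} {w} → Reduced (l ∷ l' ∷ w) → cancels l l' ≡ false
Reduced-head (red-∷ c _) = c

Reduced-++⁻ˡ : ∀ (a : Expr n) {b} → Reduced (a ++ b) → Reduced a
Reduced-++⁻ˡ []           r           = red-[]
Reduced-++⁻ˡ (l ∷ [])     r           = red-[ l ]
Reduced-++⁻ˡ (l ∷ l' ∷ a) (red-∷ c r) = red-∷ c (Reduced-++⁻ˡ (l' ∷ a) r)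

Reduced-++⁻ʳ : ∀ (a : Expr n) {b} → Reduced (a ++ b) → Reduced b
Reduced-++⁻ʳ []      r = r
Reduced-++⁻ʳ (l ∷ a) r = Reduced-++⁻ʳ a (Reduced-tail r)

Reduced-++⁺ : ∀ {a : Expr n} {h b} → Reduced a → Reduced (h ∷ b) →
              (∀ {a' e} → a ≡ a' ∷ʳ e → cancels e h ≡ false) → Reduced (a ++ h ∷ b)
Reduced-++⁺ red-[]     rb junction = rb
Reduced-++⁺ red-[ l ]  rb junction = red-∷ (junction {[]} refl) rb
Reduced-++⁺ (red-∷ {l = l} c ra) rb junction =
  red-∷ c (Reduced-++⁺ ra rb (λ {a'} eq → junction {l ∷ a'} (cong (l ∷_) eq)))

push-noncancel : ∀ {l l' : Letter n} {w} → cancels l l' ≡ false → push l (l' ∷ w) ≡ l ∷ l' ∷ w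
push-noncancel c rewrite c = refl

push-cancel : ∀ {l l' : Letter n} {w} → cancels l l' ≡ true → push l (l' ∷ w) ≡ w
push-cancel c rewrite c = refl

push-reduced : ∀ (l : Letter n) {w} → Reduced w → Reduced (push l w)
push-reduced l red-[] = red-[ l ]
push-reduced l (red-[ l' ]) with cancels l l' in c
... | true  = red-[]
... | false = red-∷ c red-[ l' ]
push-reduced l (red-∷ {l = l'} c' r) with cancels l l' in c
... | true  = r
... | false = red-∷ c (red-∷ c' r)

pushAll : Expr n → Expr n → Expr n
pushAll a w = foldr push w a

pushAll-reduced : ∀ (a : Expr n) {w} → Reduced w → Reduced (pushAll a w)
pushAll-reduced []      r = r
pushAll-reduced (l ∷ a) r = push-reduced l (pushAll-reduced a r)

reduce-reduced : (a : Expr n) → Reduced (reduce a)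
reduce-reduced a = pushAll-reduced a red-[]

reduce-idem : ∀ {w : Expr n} → Reduced w → reduce w ≡ w
reduce-idem red-[]      = refl
reduce-idem red-[ _ ]   = refl
reduce-idem (red-∷ c r) rewrite reduce-idem r = push-noncancel c

reduce-++ : (a b : Expr n) → reduce (a ++ b) ≡ pushAll a (reduce b)
reduce-++ a b = foldr-++ push [] a b

push-push-cancel : ∀ {l l' : Letter n} {w} → Reduced w → cancels l l' ≡ true → push l (push l' w) ≡ w
push-push-cancel {l = l} {l'} red-[] c rewrite c = refl
push-push-cancel {l = l} {l'} {l'' ∷ w} r c with cancels l' l'' in c'
... | false rewrite c = refl
... | true with cancels⇒≡-ₗ l l' c | cancels⇒≡-ₗ l' l'' c'
... | refl | refl rewrite -ₗ-involutive l with r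
... | red-[ _ ]    = refl
... | red-∷ c'' _ = push-noncancel c''

push-pushAll : ∀ (l : Letter n) {v w} → Reduced v → Reduced w → push l (pushAll v w) ≡ pushAll (push l v) w
push-pushAll l {[]}     rv rw = refl
push-pushAll l {l' ∷ v} rv rw with cancels l l' in c
... | true  = push-push-cancel (pushAll-reduced v rw) c
... | false = refl

pushAll-reduce : ∀ (a : Expr n) {w} → Reduced w → pushAll a w ≡ pushAll (reduce a) w
pushAll-reduce []      rw = refl
pushAll-reduce (l ∷ a) rw rewrite pushAll-reduce a rw = push-pushAll l (reduce-reduced a) rw

infix 4 _≈_
record _≈_ (a b : Expr n) : Set where
  constructor mk≈
  field ≈⇒reduce≡ : reduce a ≡ reduce b
open _≈_

≈-refl : {a : Expr n} → a ≈ a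
≈-refl = mk≈ refl

≈-sym : {a b : Expr n} → a ≈ b → b ≈ a
≈-sym (mk≈ p) = mk≈ (sym p)

≈-trans : {a b c : Expr n} → a ≈ b → b ≈ c → a ≈ c
≈-trans (mk≈ p) (mk≈ q) = mk≈ (trans p q)

≈-isEquivalence : IsEquivalence (_≈_ {n})
≈-isEquivalence = record { refl = ≈-refl ; sym = ≈-sym ; trans = ≈-trans }

≡⇒≈ : {a b : Expr n} → a ≡ b → a ≈ b
≡⇒≈ refl = mk≈ refl

reduce≈ : (a : Expr n) → reduce a ≈ a
reduce≈ a = mk≈ (reduce-idem (reduce-reduced a))

++-congˡ : (a : Expr n) {b b' : Expr n} → b ≈ b' → a ++ b ≈ a ++ b'
++-congˡ a {b} {b'} (mk≈ e) = mk≈ (begin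
  reduce (a ++ b)        ≡⟨ reduce-++ a b ⟩
  pushAll a (reduce b)   ≡⟨ cong (pushAll a) e ⟩
  pushAll a (reduce b')  ≡⟨ reduce-++ a b' ⟨
  reduce (a ++ b')       ∎)
  where open ≡-Reasoning

++-congʳ : {a a' : Expr n} (b : Expr n) → a ≈ a' → a ++ b ≈ a' ++ b
++-congʳ {a = a} {a'} b (mk≈ e) = mk≈ (begin
  reduce (a ++ b)                 ≡⟨ reduce-++ a b ⟩
  pushAll a (reduce b)            ≡⟨ pushAll-reduce a (reduce-reduced b) ⟩
  pushAll (reduce a) (reduce b)   ≡⟨ cong (λ k → pushAll k (reduce b)) e ⟩
  pushAll (reduce a') (reduce b)  ≡⟨ pushAll-reduce a' (reduce-reduced b) ⟨
  pushAll a' (reduce b)           ≡⟨ reduce-++ a' b ⟨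
  reduce (a' ++ b)                ∎)
  where open ≡-Reasoning

++-cong : {a a' b b' : Expr n} → a ≈ a' → b ≈ b' → a ++ b ≈ a' ++ b'
++-cong {a' = a'} {b = b} p q = ≈-trans (++-congʳ b p) (++-congˡ a' q)

cancel-pair : (l : Letter n) (w : Expr n) → l ∷ -ₗ l ∷ w ≈ w
cancel-pair l w = mk≈ (push-push-cancel (reduce-reduced w) (cancels-ₗ l))

≈-setoid : ℕ → Setoid 0ℓ 0ℓ
≈-setoid n = record { isEquivalence = ≈-isEquivalence {n} }

-ₑ-inverseʳ : (a : Expr n) → a ++ -ₑ a ≈ []
-ₑ-inverseʳ []      = mk≈ refl
-ₑ-inverseʳ (l ∷ a) = begin
  l ∷ a ++ -ₑ (l ∷ a)              ≡⟨ cong (λ k → l ∷ a ++ k) (-ₑ-∷ l a) ⟩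
  l ∷ a ++ (-ₑ a ++ [ -ₗ l ])      ≡⟨ cong (l ∷_) (++-assoc a (-ₑ a) _) ⟨
  [ l ] ++ (a ++ -ₑ a) ++ [ -ₗ l ] ≈⟨ ++-congˡ [ l ] (++-congʳ [ -ₗ l ] (-ₑ-inverseʳ a)) ⟩
  l ∷ -ₗ l ∷ []                    ≈⟨ cancel-pair l [] ⟩
  []                               ∎
  where open SetoidReasoning (≈-setoid _)

-ₑ-inverseˡ : (a : Expr n) → -ₑ a ++ a ≈ []
-ₑ-inverseˡ a = subst (λ k → -ₑ a ++ k ≈ []) (-ₑ-involutive a) (-ₑ-inverseʳ (-ₑ a))

-ₑ-cong : {a b : Expr n} → a ≈ b → -ₑ a ≈ -ₑ b
-ₑ-cong {a = a} {b} a≈b = begin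
  -ₑ a                  ≡⟨ ++-identityʳ (-ₑ a) ⟨
  -ₑ a ++ []            ≈⟨ ++-congˡ (-ₑ a) (-ₑ-inverseʳ b) ⟨
  -ₑ a ++ (b ++ -ₑ b)   ≡⟨ ++-assoc (-ₑ a) b (-ₑ b) ⟨
  (-ₑ a ++ b) ++ -ₑ b   ≈⟨ ++-congʳ (-ₑ b) (++-congˡ (-ₑ a) a≈b) ⟨
  (-ₑ a ++ a) ++ -ₑ b   ≈⟨ ++-congʳ (-ₑ b) (-ₑ-inverseˡ a) ⟩
  -ₑ b                  ∎
  where open SetoidReasoning (≈-setoid _)

freeGroup : ℕ → Group 0ℓ 0ℓ
freeGroup n = record
  { Carrier = Expr n
  ; _≈_     = _≈_
  ; _∙_     = _++_
  ; ε       = []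
  ; _⁻¹     = -ₑ_
  ; isGroup = record
    { isMonoid = record
      { isSemigroup = record
        { isMagma = record { isEquivalence = ≈-isEquivalence ; ∙-cong = ++-cong }
        ; assoc   = λ a b c → ≡⇒≈ (++-assoc a b c)
        }
      ; identity = (λ _ → mk≈ refl) , (λ a → ≡⇒≈ (++-identityʳ a))
      }
    ; inverse = -ₑ-inverseˡ , -ₑ-inverseʳ
    ; ⁻¹-cong = -ₑ-cong
    }
  }

reduced⇒≉[] : ∀ {x : Expr n} → Reduced x → x ≢ [] → ¬ x ≈ []
reduced⇒≉[] rx x≢[] (mk≈ e) = x≢[] (trans (sym (reduce-idem rx)) e)

module FreeGroup {n : ℕ} = Commutators (freeGroup n)
open FreeGroup
  using (conj; ⁅⁆-zeroˡ; ⁅⁆-zeroʳ; ⁅⁆≈ε⇒comm; conj-homo; conj-cong; conj-comm; conj≈ε⇒≈ε; conj-cancel; ≈ε⇒conj≈ε)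

cancel-inverse : (a w : Expr n) → a ++ (-ₑ a ++ w) ≈ w
cancel-inverse a w = begin
  a ++ (-ₑ a ++ w)   ≡⟨ ++-assoc a (-ₑ a) w ⟨
  (a ++ -ₑ a) ++ w   ≈⟨ ++-congʳ w (-ₑ-inverseʳ a) ⟩
  w                  ∎
  where open SetoidReasoning (≈-setoid _)

·-cong : (k : ℕ) {x y : Expr n} → x ≈ y → k · x ≈ k · y
·-cong zero    x≈y = mk≈ refl
·-cong (suc k) x≈y = ++-cong x≈y (·-cong k x≈y)

·-zero : (k : ℕ) {x : Expr n} → x ≈ [] → k · x ≈ []
·-zero zero    x≈0 = mk≈ refl
·-zero (suc k) x≈0 = ++-cong x≈0 (·-zero k x≈0)

conj-· : (k : ℕ) (u x : Expr n) → conj u (k · x) ≈ k · conj u x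
conj-· zero    u x = -ₑ-inverseˡ u
conj-· (suc k) u x = begin
  conj u (x ++ k · x)          ≈⟨ conj-homo u x (k · x) ⟩
  conj u x ++ conj u (k · x)   ≈⟨ ++-congˡ (conj u x) (conj-· k u x) ⟩
  conj u x ++ k · conj u x     ∎
  where open SetoidReasoning (≈-setoid _)

-- Deleting variables
module _ (S : Subset n) where

  ∣-++ : (a b : Expr n) → (a ++ b) ∣ S ≡ (a ∣ S) ++ (b ∣ S)
  ∣-++ = filter-++ _

  ∣-[-ₗ] : (l : Letter n) → [ -ₗ l ] ∣ S ≡ -ₑ ([ l ] ∣ S)
  ∣-[-ₗ] (x , b) with lookup S x
  ... | true  = refl
  ... | false = refl

  ∣--ₑ : (a : Expr n) → (-ₑ a) ∣ S ≡ -ₑ (a ∣ S)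
  ∣--ₑ []      = refl
  ∣--ₑ (l ∷ a) = begin
    (-ₑ (l ∷ a)) ∣ S                    ≡⟨ cong (_∣ S) (-ₑ-∷ l a) ⟩
    (-ₑ a ++ [ -ₗ l ]) ∣ S              ≡⟨ ∣-++ (-ₑ a) [ -ₗ l ] ⟩
    ((-ₑ a) ∣ S) ++ ([ -ₗ l ] ∣ S)      ≡⟨ cong₂ _++_ (∣--ₑ a) (∣-[-ₗ] l) ⟩
    -ₑ (a ∣ S) ++ -ₑ ([ l ] ∣ S)        ≡⟨ -ₑ-++ ([ l ] ∣ S) (a ∣ S) ⟨
    -ₑ (([ l ] ∣ S) ++ (a ∣ S))         ≡⟨ cong -ₑ_ (∣-++ [ l ] a) ⟨
    -ₑ ((l ∷ a) ∣ S)                    ∎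
    where open ≡-Reasoning

  ∣-push : (l : Letter n) (w : Expr n) → push l w ∣ S ≈ (l ∷ w) ∣ S
  ∣-push l []       = mk≈ refl
  ∣-push l (l' ∷ w) with cancels l l' in c
  ... | false = mk≈ refl
  ... | true with cancels⇒≡-ₗ l l' c
  ... | refl = begin
    w ∣ S                                          ≈⟨ cancel-inverse ([ l ] ∣ S) (w ∣ S) ⟨
    ([ l ] ∣ S) ++ (-ₑ ([ l ] ∣ S) ++ (w ∣ S))     ≡⟨ cong (λ k → ([ l ] ∣ S) ++ (k ++ (w ∣ S))) (∣-[-ₗ] l) ⟨
    ([ l ] ∣ S) ++ (([ -ₗ l ] ∣ S) ++ (w ∣ S))     ≡⟨ cong (([ l ] ∣ S) ++_) (∣-++ [ -ₗ l ] w) ⟨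
    ([ l ] ∣ S) ++ ((-ₗ l ∷ w) ∣ S)                ≡⟨ ∣-++ [ l ] (-ₗ l ∷ w) ⟨
    (l ∷ -ₗ l ∷ w) ∣ S                             ∎
    where open SetoidReasoning (≈-setoid _)

  ∣-reduce : (a : Expr n) → reduce a ∣ S ≈ a ∣ S
  ∣-reduce []      = mk≈ refl
  ∣-reduce (l ∷ a) = begin
    push l (reduce a) ∣ S              ≈⟨ ∣-push l (reduce a) ⟩
    (l ∷ reduce a) ∣ S                 ≡⟨ ∣-++ [ l ] (reduce a) ⟩
    ([ l ] ∣ S) ++ (reduce a ∣ S)      ≈⟨ ++-congˡ ([ l ] ∣ S) (∣-reduce a) ⟩
    ([ l ] ∣ S) ++ (a ∣ S)             ≡⟨ ∣-++ [ l ] a ⟨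
    (l ∷ a) ∣ S                        ∎
    where open SetoidReasoning (≈-setoid _)

  ∣-cong : {a b : Expr n} → a ≈ b → a ∣ S ≈ b ∣ S
  ∣-cong {a} {b} (mk≈ e) = begin
    a ∣ S          ≈⟨ ∣-reduce a ⟨
    reduce a ∣ S   ≡⟨ cong (_∣ S) e ⟩
    reduce b ∣ S   ≈⟨ ∣-reduce b ⟩
    b ∣ S          ∎
    where open SetoidReasoning (≈-setoid _)

  ∣-⟦⟧ : (a b : Expr n) → ⟦ a , b ⟧ ∣ S ≡ ⟦ a ∣ S , b ∣ S ⟧
  ∣-⟦⟧ a b = begin
    ⟦ a , b ⟧ ∣ S                                       ≡⟨ ∣-++ a _ ⟩
    (a ∣ S) ++ ((b ++ -ₑ a ++ -ₑ b) ∣ S)                ≡⟨ cong ((a ∣ S) ++_) (∣-++ b _) ⟩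
    (a ∣ S) ++ (b ∣ S) ++ ((-ₑ a ++ -ₑ b) ∣ S)          ≡⟨ cong (((a ∣ S) ++_) ∘ ((b ∣ S) ++_)) (∣-++ (-ₑ a) (-ₑ b)) ⟩
    (a ∣ S) ++ (b ∣ S) ++ ((-ₑ a) ∣ S) ++ ((-ₑ b) ∣ S)  ≡⟨ cong (((a ∣ S) ++_) ∘ ((b ∣ S) ++_)) (cong₂ _++_ (∣--ₑ a) (∣--ₑ b)) ⟩
    ⟦ a ∣ S , b ∣ S ⟧                                   ∎
    where open ≡-Reasoning

  ∣-conj : (u x : Expr n) → conj u x ∣ S ≡ conj (u ∣ S) (x ∣ S)
  ∣-conj u x = begin
    (-ₑ u ++ (x ++ u)) ∣ S                   ≡⟨ ∣-++ (-ₑ u) (x ++ u) ⟩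
    ((-ₑ u) ∣ S) ++ ((x ++ u) ∣ S)           ≡⟨ cong₂ _++_ (∣--ₑ u) (∣-++ x u) ⟩
    -ₑ (u ∣ S) ++ ((x ∣ S) ++ (u ∣ S))       ∎
    where open ≡-Reasoning

∣-∣ : {S S' : Subset n} → S ⊆ S' → (a : Expr n) → (a ∣ S) ∣ S' ≡ a ∣ S'
∣-∣ S⊆S' [] = refl
∣-∣ {S = S} {S'} S⊆S' ((x , b) ∷ a) with lookup S' x in x∈S'
... | true  with lookup S x
...   | true  = ∣-∣ S⊆S' a
...   | false rewrite x∈S' = ∣-∣ S⊆S' a
∣-∣ {S = S} {S'} S⊆S' ((x , b) ∷ a) | false with lookup S x in x∈S
...   | true  = contradiction (trans (sym ([]=⇒lookup (S⊆S' (lookup⇒[]= x S x∈S)))) x∈S') λ ()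
...   | false rewrite x∈S' = cong ((x , b) ∷_) (∣-∣ S⊆S' a)

∣-· : (S : Subset n) (k : ℕ) (x : Expr n) → (k · x) ∣ S ≡ k · (x ∣ S)
∣-· S zero    x = refl
∣-· S (suc k) x = trans (∣-++ S x (k · x)) (cong ((x ∣ S) ++_) (∣-· S k x))

-- Cyclic reduction and torsion-freeness
CyclicallyReduced : Expr n → Set
CyclicallyReduced c = ∀ {h m e} → c ≡ h ∷ (m ∷ʳ e) → cancels e h ≡ false

·-reduced : ∀ {c : Expr n} → Reduced c → CyclicallyReduced c → ∀ k → Reduced (suc k · c)
·-reduced {c = c}      rc cyc zero    = subst Reduced (sym (++-identityʳ c)) rc
·-reduced {c = []}     rc cyc (suc k) = ·-reduced rc cyc k
·-reduced {c = h ∷ c'} rc cyc (suc k) = Reduced-++⁺ rc (·-reduced rc cyc k) junction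
  where
  junction : ∀ {a' e} → h ∷ c' ≡ a' ∷ʳ e → cancels e h ≡ false
  junction {[]}     refl = cancels-self h
  junction {_ ∷ a'} eq with refl , _ ← ∷-injective eq = cyc eq

record CyclicDecomposition (g : Expr n) : Set where
  field
    conjugator : Expr n
    core       : Expr n
    g≡         : g ≡ conjugator ++ (core ++ -ₑ conjugator)
    reduced    : Reduced core
    nonempty   : core ≢ []
    cyclic     : CyclicallyReduced core

cyclicDecomposition′ : ∀ (g : Expr n) → Acc _<_ (length g) → Reduced g → g ≢ [] → CyclicDecomposition g
cyclicDecomposition′ [] _ _ g≢[] = contradiction refl g≢[]
cyclicDecomposition′ (h ∷ t) (acc rs) rg _ with initLast t
... | [] = record
  { conjugator = [] ; core = [ h ] ; g≡ = refl ; reduced = rg ; nonempty = λ () ; cyclic = cyclic }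
  where
  cyclic : CyclicallyReduced [ h ]
  cyclic {m = []}    ()
  cyclic {m = _ ∷ _} ()
... | m ∷ʳ′ e with cancels e h in e≁h
...   | false = record
  { conjugator = [] ; core = h ∷ (m ∷ʳ e) ; g≡ = sym (++-identityʳ _) ; reduced = rg ; nonempty = λ () ; cyclic = cyclic }
  where
  cyclic : CyclicallyReduced (h ∷ (m ∷ʳ e))
  cyclic eq with refl , eq′ ← ∷-injective eq with refl , refl ← ∷ʳ-injective m _ eq′ = e≁h
...   | true with refl ← cancels⇒≡-ₗ e h e≁h = record
  { conjugator = -ₗ e ∷ u ; core = c ; g≡ = g≡′ ; reduced = reduced ; nonempty = nonempty ; cyclic = cyclic }
  where
  rm : Reduced m
  rm = Reduced-++⁻ˡ m (Reduced-tail rg)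
  m≢[] : m ≢ []
  m≢[] refl = contradiction (trans (sym (Reduced-head rg)) (cancels-ₗˡ e)) λ ()
  m<g : length m < length (-ₗ e ∷ (m ∷ʳ e))
  m<g = s≤s (subst (length m ≤_) (sym (length-++ m)) (m≤m+n (length m) 1))
  open CyclicDecomposition (cyclicDecomposition′ m (rs m<g) rm m≢[]) renaming (conjugator to u; core to c; g≡ to m≡)
  g≡′ : -ₗ e ∷ (m ∷ʳ e) ≡ (-ₗ e ∷ u) ++ (c ++ -ₑ (-ₗ e ∷ u))
  g≡′ = cong (-ₗ e ∷_) (begin
    m ++ [ e ]                               ≡⟨ cong (_++ [ e ]) m≡ ⟩
    (u ++ (c ++ -ₑ u)) ++ [ e ]              ≡⟨ ++-assoc u _ _ ⟩
    u ++ ((c ++ -ₑ u) ++ [ e ])              ≡⟨ cong (u ++_) (++-assoc c _ _) ⟩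
    u ++ (c ++ (-ₑ u ++ [ e ]))              ≡⟨ cong (λ l → u ++ (c ++ (-ₑ u ++ [ l ]))) (-ₗ-involutive e) ⟨
    u ++ (c ++ (-ₑ u ++ [ -ₗ -ₗ e ]))        ≡⟨ cong (λ k → u ++ (c ++ k)) (-ₑ-∷ (-ₗ e) u) ⟨
    u ++ (c ++ -ₑ (-ₗ e ∷ u))                ∎)
    where open ≡-Reasoning

cyclicDecomposition : ∀ (g : Expr n) → Reduced g → g ≢ [] → CyclicDecomposition g
cyclicDecomposition g = cyclicDecomposition′ g (<-wellFounded (length g))

·-≢[] : ∀ {c : Expr n} k → c ≢ [] → suc k · c ≢ []
·-≢[] {c = []}    k c≢[] = contradiction refl c≢[]
·-≢[] {c = _ ∷ _} k _    = λ ()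

·-torsionFree : (k : ℕ) (w : Expr n) → suc k · w ≈ [] → w ≈ []
·-torsionFree k w kw≈0 with reduce w in w↓
... | []    = mk≈ w↓
... | g@(_ ∷ _) = contradiction kc≈0 (reduced⇒≉[] (·-reduced reduced cyclic k) (·-≢[] k nonempty))
  where
  open CyclicDecomposition (cyclicDecomposition g (subst Reduced w↓ (reduce-reduced w)) λ ())
  open SetoidReasoning (≈-setoid _)
  kc≈0 : suc k · core ≈ []
  kc≈0 = begin
    suc k · core                                                     ≈⟨ ·-cong (suc k) (conj-cancel conjugator core) ⟨
    suc k · conj conjugator (conjugator ++ (core ++ -ₑ conjugator))  ≡⟨ cong (λ h → suc k · conj conjugator h) g≡ ⟨
    suc k · conj conjugator g                                        ≈⟨ conj-· (suc k) conjugator g ⟨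
    conj conjugator (suc k · g)                                      ≈⟨ ≈ε⇒conj≈ε conjugator kg≈0 ⟩
    []                                                               ∎
    where
    kg≈0 : suc k · g ≈ []
    kg≈0 = ≈-trans (·-cong (suc k) (subst (_≈ w) w↓ (reduce≈ w))) kw≈0

-- Centralisers and deletions
record ZeroImplies (x y : Expr n) : Set where
  constructor zeroImplies
  field zero⇒zero : ∀ S → x ∣ S ≈ [] → y ∣ S ≈ []
open ZeroImplies

ZeroImplies-refl : {x : Expr n} → ZeroImplies x x
ZeroImplies-refl = zeroImplies λ _ x∣S≈0 → x∣S≈0

ZeroImplies--ₑ : {x y : Expr n} → ZeroImplies x y → ZeroImplies x (-ₑ y)
ZeroImplies--ₑ {y = y} x⇒y = zeroImplies λ S x∣S≈0 →
  subst (_≈ []) (sym (∣--ₑ S y)) (-ₑ-cong (zero⇒zero x⇒y S x∣S≈0))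

ZeroImplies-++ : {x y z : Expr n} → ZeroImplies x y → ZeroImplies x z → ZeroImplies x (y ++ z)
ZeroImplies-++ {y = y} {z} x⇒y x⇒z = zeroImplies λ S x∣S≈0 →
  subst (_≈ []) (sym (∣-++ S y z)) (++-cong (zero⇒zero x⇒y S x∣S≈0) (zero⇒zero x⇒z S x∣S≈0))

ZeroImplies-resp-≈ : {x x' y y' : Expr n} → x ≈ x' → y ≈ y' → ZeroImplies x y → ZeroImplies x' y'
ZeroImplies-resp-≈ x≈x' y≈y' x⇒y = zeroImplies λ S x'∣S≈0 →
  ≈-trans (∣-cong S (≈-sym y≈y')) (zero⇒zero x⇒y S (≈-trans (∣-cong S x≈x') x'∣S≈0))

ZeroImplies-conj : (u : Expr n) {x y : Expr n} → ZeroImplies (conj u x) (conj u y) → ZeroImplies x y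
ZeroImplies-conj u {x} {y} ux⇒uy = zeroImplies λ S x∣S≈0 →
  conj≈ε⇒≈ε (u ∣ S) (y ∣ S) (subst (_≈ []) (∣-conj S u y)
    (zero⇒zero ux⇒uy S (subst (_≈ []) (sym (∣-conj S u x)) (≈ε⇒conj≈ε (u ∣ S) x∣S≈0))))

ZeroImplies-· : (i j : ℕ) (r : Expr n) → ZeroImplies (suc i · r) (j · r)
ZeroImplies-· i j r = zeroImplies λ S ir∣S≈0 →
  subst (_≈ []) (sym (∣-· S j r)) (·-zero j (·-torsionFree i (r ∣ S) (subst (_≈ []) (∣-· S (suc i) r) ir∣S≈0)))

ZeroImplies-above : ∀ (a b : Expr n) {S S'} → ZeroImplies (a ∣ S) (b ∣ S) → S ⊆ S' → a ∣ S' ≈ [] → b ∣ S' ≈ []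
ZeroImplies-above a b {S} {S'} a⇒b S⊆S' a∣S'≈0 =
  subst (_≈ []) (∣-∣ S⊆S' b) (zero⇒zero a⇒b S' (subst (_≈ []) (sym (∣-∣ S⊆S' a)) a∣S'≈0))

++-comm⇒ZeroImplies : {c b : Expr n} → c ≢ [] → c ++ b ≡ b ++ c → ZeroImplies c b
++-comm⇒ZeroImplies {c = c} {b} c≢[] comm with ++-comm⇒commonRoot c b comm
... | record { root = r ; i = suc i ; j = j ; xs≡ = refl ; ys≡ = refl } = ZeroImplies-· i j r
... | record { i = zero ; xs≡ = refl } = contradiction refl c≢[]

record Cancellation (x y : Expr n) : Set where
  constructor cancellation
  field
    left middle right : Expr n
    x≡         : x ≡ left ++ middle
    y≡         : y ≡ -ₑ middle ++ right
    reduce-++≡ : reduce (x ++ y) ≡ left ++ right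

  length-cancellation : length x + length y ≡ length (reduce (x ++ y)) + 2 * length middle
  length-cancellation rewrite reduce-++≡ | x≡ | y≡
                 | length-++ left {middle} | length-++ (-ₑ middle) {right} | length-++ left {right} | length--ₑ middle
                 = arithmetic (length left) (length middle) (length right)
    where
    arithmetic : ∀ l m r → (l + m) + (m + r) ≡ (l + r) + 2 * m
    arithmetic = solve-∀

  middle≡[]⇒reduced : middle ≡ [] → reduce (x ++ y) ≡ x ++ y
  middle≡[]⇒reduced m≡[] = begin
    reduce (x ++ y)  ≡⟨ reduce-++≡ ⟩
    left ++ right    ≡⟨ cong₂ _++_ x≡left y≡right ⟨
    x ++ y           ∎
    where
    open ≡-Reasoning
    x≡left : x ≡ left
    x≡left = trans x≡ (trans (cong (left ++_) m≡[]) (++-identityʳ left))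
    y≡right : y ≡ right
    y≡right = trans y≡ (cong (λ m → -ₑ m ++ right) m≡[])

∷-cancellation : ∀ {l : Letter n} {x y} → Reduced (l ∷ x) → Cancellation x y → Cancellation (l ∷ x) y
∷-cancellation {l = l} rlx (cancellation (m ∷ x₁) z y₁ refl refl e) =
  cancellation (l ∷ m ∷ x₁) z y₁ refl refl (trans (cong (push l) e) (push-noncancel (Reduced-head rlx)))
∷-cancellation {l = l} rlx (cancellation [] z [] refl refl e) =
  cancellation [ l ] z [] refl refl (cong (push l) e)
∷-cancellation {l = l} rlx (cancellation [] z (m ∷ y₁) refl refl e) with cancels l m in l∼m
... | false = cancellation [ l ] z (m ∷ y₁) refl refl (trans (cong (push l) e) (push-noncancel l∼m))
... | true with refl ← cancels⇒≡-ₗ l m l∼m =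
  cancellation [] (l ∷ z) y₁ refl y≡ (trans (cong (push l) e) (push-cancel l∼m))
  where
  y≡ : -ₑ z ++ -ₗ l ∷ y₁ ≡ -ₑ (l ∷ z) ++ y₁
  y≡ = trans (sym (++-assoc (-ₑ z) [ -ₗ l ] y₁)) (cong (_++ y₁) (sym (-ₑ-∷ l z)))

reduced-cancellation : ∀ {x y : Expr n} → Reduced x → Reduced y → Cancellation x y
reduced-cancellation {x = []} {y} _ ry = cancellation [] [] y refl refl (reduce-idem ry)
reduced-cancellation {x = l ∷ x} rx ry = ∷-cancellation rx (reduced-cancellation (Reduced-tail rx) ry)

module _ {x y : Expr n} (xy : Cancellation x y) (yx : Cancellation y x) (comm : x ++ y ≈ y ++ x) where
  private
    module XY = Cancellation xy
    module YX = Cancellation yx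

  middle-length : length XY.middle ≡ length YX.middle
  middle-length = *-cancelˡ-≡ _ _ 2 (+-cancelˡ-≡ (length (reduce (x ++ y))) _ _ (begin
    length (reduce (x ++ y)) + 2 * length XY.middle  ≡⟨ XY.length-cancellation ⟨
    length x + length y                              ≡⟨ +-comm (length x) (length y) ⟩
    length y + length x                              ≡⟨ YX.length-cancellation ⟩
    length (reduce (y ++ x)) + 2 * length YX.middle  ≡⟨ cong (λ w → length w + 2 * length YX.middle) (≈⇒reduce≡ comm) ⟨
    length (reduce (x ++ y)) + 2 * length YX.middle  ∎))
    where open ≡-Reasoning

  left++right-≡ : XY.left ++ XY.right ≡ YX.left ++ YX.right
  left++right-≡ = trans (sym XY.reduce-++≡) (trans (≈⇒reduce≡ comm) YX.reduce-++≡)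

  middle≡[]⇒++-comm : XY.middle ≡ [] → x ++ y ≡ y ++ x
  middle≡[]⇒++-comm m≡[] with YX.middle in m′≡ | middle-length
  ... | []    | _ = begin
    x ++ y           ≡⟨ XY.middle≡[]⇒reduced m≡[] ⟨
    reduce (x ++ y)  ≡⟨ ≈⇒reduce≡ comm ⟩
    reduce (y ++ x)  ≡⟨ YX.middle≡[]⇒reduced m′≡ ⟩
    y ++ x           ∎
    where open ≡-Reasoning
  ... | _ ∷ _ | |m|≡|m′| = contradiction (trans (cong length (sym m≡[])) |m|≡|m′|) λ ()

cyclicallyReduced-conflict : ∀ {c b : Expr n} {h h' c₁ b₁ b₂ w} (z : Expr n) → CyclicallyReduced c → z ≢ [] →
                             c ≡ h ∷ c₁ ++ z → b ≡ -ₑ z ++ b₁ → b ≡ h' ∷ b₂ ++ w → h ≡ h' → ⊥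
cyclicallyReduced-conflict z _ z≢[] _ _ _ _ with initLast z
... | [] = z≢[] refl
cyclicallyReduced-conflict {h = h} {c₁ = c₁} {b₁} _ cyc _ c≡ b≡ b≡′ refl | zi ∷ʳ′ e =
  contradiction (trans (sym e≁h) (subst (λ l → cancels e l ≡ true) (sym h≡-e) (cancels-ₗ e))) λ ()
  where
  e≁h : cancels e h ≡ false
  e≁h = cyc (trans c≡ (cong (h ∷_) (sym (++-assoc c₁ zi [ e ]))))
  h≡-e : h ≡ -ₗ e
  h≡-e = ∷-injectiveˡ (trans (sym b≡′) (trans b≡ (cong (_++ b₁) (-ₑ-++ zi [ e ]))))

commuting-suffix⇒ZeroImplies : ∀ {c z : Expr n} c₁ → c ≢ [] → c ≡ c₁ ++ z → c ≡ z ++ c₁ → ZeroImplies c (-ₑ z)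
commuting-suffix⇒ZeroImplies {c = c} {z} c₁ c≢[] c≡c₁z c≡zc₁ = ZeroImplies--ₑ (++-comm⇒ZeroImplies c≢[] (begin
  c ++ z           ≡⟨ cong (_++ z) c≡zc₁ ⟩
  (z ++ c₁) ++ z   ≡⟨ ++-assoc z c₁ z ⟩
  z ++ (c₁ ++ z)   ≡⟨ cong (z ++_) c≡c₁z ⟨
  z ++ c           ∎))
  where open ≡-Reasoning

-- Write c = c₁ z, b = z⁻¹ b₁ with reduce (c b) = c₁ b₁, and b = b₂ w, c = w⁻¹ c₂ with reduce (b c) = b₂ c₂;
-- then |z| = |w|. If nothing cancels, c and b commute as words. If all of c cancels, b₁ = c b commutes with c
-- and is shorter. Otherwise c₁ ≠ [], and b₂ ≠ [] would make the last letter of c cancel its first one;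
-- so b₂ = [], whence b = z⁻¹ and z commutes with c as a word.
centraliser-step : ∀ {c b : Expr n} → CyclicallyReduced c → c ≢ [] → Reduced b → c ++ b ≈ b ++ c →
                   (∀ {b₁} → length b₁ < length b → Reduced b₁ → c ++ b₁ ≈ b₁ ++ c → ZeroImplies c b₁) →
                   Cancellation c b → Cancellation b c → ZeroImplies c b
centraliser-step cyc c≢[] rb comm IH cb@(cancellation _ [] _ _ _ _) bc =
  ++-comm⇒ZeroImplies c≢[] (middle≡[]⇒++-comm cb bc comm refl)
centraliser-step cyc c≢[] rb comm IH (cancellation [] z@(_ ∷ _) b₁ refl refl _) _ =
  ZeroImplies-++ (ZeroImplies--ₑ ZeroImplies-refl) (IH b₁<b (Reduced-++⁻ʳ (-ₑ z) rb) b₁-comm)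
  where
  b₁<b : length b₁ < length (-ₑ z ++ b₁)
  b₁<b = subst (length b₁ <_) (sym (trans (length-++ (-ₑ z)) (cong (_+ length b₁) (length--ₑ z))))
               (m<n+m (length b₁) (s≤s z≤n))
  b₁-comm : z ++ b₁ ≈ b₁ ++ z
  b₁-comm = begin
    z ++ b₁                   ≈⟨ ++-congˡ z (cancel-inverse z b₁) ⟨
    z ++ (z ++ (-ₑ z ++ b₁))  ≈⟨ ++-congˡ z comm ⟩
    z ++ ((-ₑ z ++ b₁) ++ z)  ≡⟨ ++-assoc z _ z ⟨
    (z ++ (-ₑ z ++ b₁)) ++ z  ≈⟨ ++-congʳ z (cancel-inverse z b₁) ⟩
    b₁ ++ z                   ∎
    where open SetoidReasoning (≈-setoid _)
centraliser-step cyc c≢[] rb comm IH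
                 cb@(cancellation (_ ∷ _) z@(_ ∷ _) _ c≡ b≡ _) bc@(cancellation (_ ∷ b₂) w _ b≡′ _ _) =
  ⊥-elim (cyclicallyReduced-conflict {b₂ = b₂} {w} z cyc (λ ()) c≡ b≡ b≡′ (∷-injectiveˡ (left++right-≡ cb bc comm)))
centraliser-step cyc c≢[] rb comm IH
                 cb@(cancellation _ z@(_ ∷ _) (_ ∷ b₁) _ b≡ _) bc@(cancellation [] _ _ refl _ _) =
  contradiction (trans (middle-length cb bc comm) (trans (cong length b≡)
                  (trans (length-++ (-ₑ z)) (trans (cong (_+ _) (length--ₑ z)) (+-suc (length z) (length b₁))))))
                (m≢1+m+n (length z))
centraliser-step {c = c} {b} cyc c≢[] rb comm IH
                 cb@(cancellation c₁ z@(_ ∷ _) [] c≡ b≡ _) bc@(cancellation [] _ c₂ refl c≡′ _) =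
  subst (ZeroImplies c) (sym (trans b≡ (++-identityʳ (-ₑ z)))) (commuting-suffix⇒ZeroImplies c₁ c≢[] c≡ c≡zc₁)
  where
  c≡zc₁ : c ≡ z ++ c₁
  c≡zc₁ = begin
    c                     ≡⟨ c≡′ ⟩
    -ₑ b ++ c₂            ≡⟨ cong₂ (λ u v → -ₑ u ++ v) (trans b≡ (++-identityʳ (-ₑ z))) (sym (left++right-≡ cb bc comm)) ⟩
    -ₑ -ₑ z ++ (c₁ ++ [])  ≡⟨ cong₂ _++_ (-ₑ-involutive z) (++-identityʳ c₁) ⟩
    z ++ c₁               ∎
    where open ≡-Reasoning

cyclicallyReduced-commute⇒ZeroImplies′ : ∀ {c b : Expr n} → Acc _<_ (length b) → Reduced c → CyclicallyReduced c → c ≢ [] →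
                                         Reduced b → c ++ b ≈ b ++ c → ZeroImplies c b
cyclicallyReduced-commute⇒ZeroImplies′ (acc rs) rc cyc c≢[] rb comm =
  centraliser-step cyc c≢[] rb comm
    (λ b₁<b rb₁ comm₁ → cyclicallyReduced-commute⇒ZeroImplies′ (rs b₁<b) rc cyc c≢[] rb₁ comm₁)
    (reduced-cancellation rc rb) (reduced-cancellation rb rc)

commute⇒ZeroImplies : (x y : Expr n) → ¬ x ≈ [] → x ++ y ≈ y ++ x → ZeroImplies x y
commute⇒ZeroImplies x y x≉0 comm with reduce x in x↓
... | []        = contradiction (mk≈ x↓) x≉0
... | g@(_ ∷ _) = ZeroImplies-conj conjugator (ZeroImplies-resp-≈ core≈ b≈ core⇒b)
  where
  open CyclicDecomposition (cyclicDecomposition g (subst Reduced x↓ (reduce-reduced x)) λ ())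
  b : Expr _
  b = reduce (conj conjugator y)
  b≈ : b ≈ conj conjugator y
  b≈ = reduce≈ (conj conjugator y)
  core≈ : core ≈ conj conjugator x
  core≈ = begin
    core                                                        ≈⟨ conj-cancel conjugator core ⟨
    conj conjugator (conjugator ++ (core ++ -ₑ conjugator))     ≡⟨ cong (conj conjugator) g≡ ⟨
    conj conjugator g                                           ≈⟨ conj-cong conjugator (subst (_≈ x) x↓ (reduce≈ x)) ⟩
    conj conjugator x                                           ∎
    where open SetoidReasoning (≈-setoid _)
  core⇒b : ZeroImplies core b
  core⇒b = cyclicallyReduced-commute⇒ZeroImplies′ (<-wellFounded _) reduced cyclic nonempty (reduce-reduced (conj conjugator y))
    (begin
      core ++ b                                    ≈⟨ ++-cong core≈ b≈ ⟩
      conj conjugator x ++ conj conjugator y       ≈⟨ conj-comm conjugator comm ⟩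
      conj conjugator y ++ conj conjugator x       ≈⟨ ++-cong b≈ core≈ ⟨
      b ++ core                                    ∎)
    where open SetoidReasoning (≈-setoid _)

⊔ₒ-fallʳ : ∀ o → o ⊔ₒ fall ≡ fall
⊔ₒ-fallʳ hang = refl
⊔ₒ-fallʳ fall = refl

⊔ₒ≡fall : ∀ o o' → o ⊔ₒ o' ≡ fall → o ≡ fall ⊎ o' ≡ fall
⊔ₒ≡fall hang _ o'≡fall = inj₂ o'≡fall
⊔ₒ≡fall fall _ _       = inj₁ refl

Any-zero⇒⋁≡fall : ∀ {hs : List (Expr n)} {gs} S → Pointwise (λ h g → Solves h (fn g)) hs gs →
                  Any (λ h → h ∣ S ≈ []) hs → ⋁ gs S ≡ fall
Any-zero⇒⋁≡fall S (h-solves ∷ _) (here h∣S≈0) rewrite proj₁ (h-solves S) (≈⇒reduce≡ h∣S≈0) = refl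
Any-zero⇒⋁≡fall {gs = g ∷ _} S (_ ∷ rest) (there any) rewrite Any-zero⇒⋁≡fall S rest any = ⊔ₒ-fallʳ (fn g S)

⋁≡fall⇒Any-zero : ∀ {hs : List (Expr n)} {gs} S → Pointwise (λ h g → Solves h (fn g)) hs gs →
                  ⋁ gs S ≡ fall → Any (λ h → h ∣ S ≈ []) hs
⋁≡fall⇒Any-zero {gs = g ∷ gs} S (h-solves ∷ rest) ⋁≡fall with ⊔ₒ≡fall (fn g S) (⋁ gs S) ⋁≡fall
... | inj₁ g≡fall  = here (mk≈ (proj₂ (h-solves S) g≡fall))
... | inj₂ gs≡fall = there (⋁≡fall⇒Any-zero S rest gs≡fall)

hang⇒¬Any-zero : ∀ {hs : List (Expr n)} {gs} S → Pointwise (λ h g → Solves h (fn g)) hs gs →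
                 ⋁ gs S ≡ hang → ¬ Any (λ h → h ∣ S ≈ []) hs
hang⇒¬Any-zero S hs-solve ⋁≡hang any with trans (sym ⋁≡hang) (Any-zero⇒⋁≡fall S hs-solve any)
... | ()

node-zero : ∀ (l r : CTree n) S → expr l ∣ S ≈ [] ⊎ expr r ∣ S ≈ [] → expr (node l r) ∣ S ≈ []
node-zero l r S (inj₁ l≈0) = subst (_≈ []) (sym (∣-⟦⟧ S (expr l) (expr r))) (⁅⁆-zeroˡ (expr r ∣ S) l≈0)
node-zero l r S (inj₂ r≈0) = subst (_≈ []) (sym (∣-⟦⟧ S (expr l) (expr r))) (⁅⁆-zeroʳ (expr l ∣ S) r≈0)

leaf-zero⇒root-zero : ∀ (T : CTree n) S → Any (λ h → h ∣ S ≈ []) (leaves T) → expr T ∣ S ≈ []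
leaf-zero⇒root-zero (leaf h)   S (here h≈0) = h≈0
leaf-zero⇒root-zero (node l r) S any =
  node-zero l r S (Sum.map (leaf-zero⇒root-zero l S) (leaf-zero⇒root-zero r S) (++⁻ (leaves l) any))

internal-zero⇒root-zero : ∀ (T : CTree n) {l r} S → (l , r) ∈ internals T → expr (node l r) ∣ S ≈ [] → expr T ∣ S ≈ []
internal-zero⇒root-zero (node l r) S (here refl) N≈0 = N≈0
internal-zero⇒root-zero (node l r) S (there N∈) N≈0 =
  node-zero l r S (Sum.map (λ N∈l → internal-zero⇒root-zero l S N∈l N≈0) (λ N∈r → internal-zero⇒root-zero r S N∈r N≈0)
                           (++⁻ (internals l) N∈))

specOf-cong : ∀ (a b : Expr n) S → (a ∣ S ≈ [] → b ∣ S ≈ []) → (b ∣ S ≈ [] → a ∣ S ≈ []) → specOf a S ≡ specOf b S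
specOf-cong a b S a⇒b b⇒a with reduce (a ∣ S) in a↓ | reduce (b ∣ S) in b↓
... | []    | []    = refl
... | []    | _ ∷ _ = contradiction (trans (sym b↓) (≈⇒reduce≡ (a⇒b (mk≈ a↓)))) λ ()
... | _ ∷ _ | []    = contradiction (trans (sym a↓) (≈⇒reduce≡ (b⇒a (mk≈ b↓)))) λ ()
... | _ ∷ _ | _ ∷ _ = refl

⟦⟧-zero⇒same-specOf-above : ∀ (a b : Expr n) {S S'} → ¬ a ∣ S ≈ [] → ¬ b ∣ S ≈ [] → ⟦ a , b ⟧ ∣ S ≈ [] →
                              S ⊆ S' → specOf a S' ≡ specOf b S'
⟦⟧-zero⇒same-specOf-above a b {S} {S'} a≉0 b≉0 ab≈0 S⊆S' =
  specOf-cong a b S' (ZeroImplies-above a b (commute⇒ZeroImplies _ _ a≉0 comm) S⊆S')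
                     (ZeroImplies-above b a (commute⇒ZeroImplies _ _ b≉0 (≈-sym comm)) S⊆S')
  where
  comm : (a ∣ S) ++ (b ∣ S) ≈ (b ∣ S) ++ (a ∣ S)
  comm = ⁅⁆≈ε⇒comm (a ∣ S) (b ∣ S) (subst (_≈ []) (∣-⟦⟧ S a b) ab≈0)

separated⇒root-nonzero : ∀ (T : CTree n) S → ¬ Any (λ h → h ∣ S ≈ []) (leaves T) →
  (∀ N → N ∈ internals T → SeparateAbove (specOf (expr (proj₁ N))) (specOf (expr (proj₂ N))) S) →
  ¬ expr T ∣ S ≈ []
separated⇒root-nonzero (leaf h)   S no-leaf-zero sep h≈0 = no-leaf-zero (here h≈0)
separated⇒root-nonzero (node l r) S no-leaf-zero sep lr≈0 with sep (l , r) (here refl)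
... | S' , S⊆S' , specs-differ =
  specs-differ (⟦⟧-zero⇒same-specOf-above (expr l) (expr r) l≉0 r≉0 lr≈0 S⊆S')
  where
  l≉0 : ¬ expr l ∣ S ≈ []
  l≉0 = separated⇒root-nonzero l S (no-leaf-zero ∘ ++⁺ˡ) (λ N N∈ → sep N (there (++⁺ˡ N∈)))
  r≉0 : ¬ expr r ∣ S ≈ []
  r≉0 = separated⇒root-nonzero r S (no-leaf-zero ∘ ++⁺ʳ (leaves l)) (λ N N∈ → sep N (there (++⁺ʳ (internals l) N∈)))

VanishingInternalNode : CTree n → (Subset n → Outcome) → Set
VanishingInternalNode {n} T f = ∃ λ (N : CTree n × CTree n) → ∃ λ (S : Subset n) →
  N ∈ internals T × f S ≡ hang × IsZero (expr (node (proj₁ N) (proj₂ N)) ∣ S)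

Solves⇒¬VanishingInternalNode : ∀ (T : CTree n) {f} → Solves (expr T) f → ¬ VanishingInternalNode T f
Solves⇒¬VanishingInternalNode T solves (N , S , N∈ , f≡hang , N≈0) with
  trans (sym f≡hang) (proj₁ (solves S) (≈⇒reduce≡ (internal-zero⇒root-zero T S N∈ (mk≈ N≈0))))
... | ()

nonzero-at-hang⇒Solves : ∀ (T : CTree n) gs → Pointwise (λ h g → Solves h (fn g)) (leaves T) gs →
                         (∀ S → ⋁ gs S ≡ hang → ¬ expr T ∣ S ≈ []) → Solves (expr T) (⋁ gs)
nonzero-at-hang⇒Solves T gs leaves-solve nonzero S = zero⇒fall , λ ⋁≡fall →
  ≈⇒reduce≡ (leaf-zero⇒root-zero T S (⋁≡fall⇒Any-zero S leaves-solve ⋁≡fall))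
  where
  zero⇒fall : IsZero (expr T ∣ S) → ⋁ gs S ≡ fall
  zero⇒fall T≈0 with ⋁ gs S in ⋁≡
  ... | hang = contradiction (mk≈ T≈0) (nonzero S ⋁≡)
  ... | fall = refl

¬VanishingInternalNode⇒nonzero-at-hang : ∀ (T : CTree n) gs → Pointwise (λ h g → Solves h (fn g)) (leaves T) gs →
  ¬ VanishingInternalNode T (⋁ gs) → ∀ S → ⋁ gs S ≡ hang → ¬ expr T ∣ S ≈ []
¬VanishingInternalNode⇒nonzero-at-hang (leaf h) gs leaves-solve _ S ⋁≡hang h≈0 =
  hang⇒¬Any-zero S leaves-solve ⋁≡hang (here h≈0)
¬VanishingInternalNode⇒nonzero-at-hang (node l r) gs _ no-vanishing S ⋁≡hang lr≈0 =
  no-vanishing ((l , r) , S , here refl , ⋁≡hang , ≈⇒reduce≡ lr≈0)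

Separated⇒Solves : ∀ (T : CTree n) gs → Pointwise (λ h g → Solves h (fn g)) (leaves T) gs →
  (∀ S → ⋁ gs S ≡ hang → ∀ N → N ∈ internals T → SeparateAbove (specOf (expr (proj₁ N))) (specOf (expr (proj₂ N))) S) →
  Solves (expr T) (⋁ gs)
Separated⇒Solves T gs leaves-solve separated = nonzero-at-hang⇒Solves T gs leaves-solve λ S ⋁≡hang →
  separated⇒root-nonzero T S (hang⇒¬Any-zero S leaves-solve ⋁≡hang) (separated S ⋁≡hang)

theorem3p3 : ∀ {n : ℕ} (T : CTree n) (gs : List (Spec n)) →
    Pointwise (λ h g → Solves h (fn g)) (leaves T) gs →
    ((Solves (expr T) (⋁ gs) →
        ¬ (∃ λ (N : CTree n × CTree n) → ∃ λ (S : Subset n) →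
             N ∈ internals T × ⋁ gs S ≡ hang × IsZero (expr (node (proj₁ N) (proj₂ N)) ∣ S)))
     × (¬ (∃ λ (N : CTree n × CTree n) → ∃ λ (S : Subset n) →
             N ∈ internals T × ⋁ gs S ≡ hang × IsZero (expr (node (proj₁ N) (proj₂ N)) ∣ S))
        → Solves (expr T) (⋁ gs)))
    × ((∀ (S : Subset n) → ⋁ gs S ≡ hang → ∀ (N : CTree n × CTree n) → N ∈ internals T →
          SeparateAbove (specOf (expr (proj₁ N))) (specOf (expr (proj₂ N))) S)
       → Solves (expr T) (⋁ gs))
theorem3p3 T gs leaves-solve =
  ( Solves⇒¬VanishingInternalNode T
  , nonzero-at-hang⇒Solves T gs leaves-solve ∘ ¬VanishingInternalNode⇒nonzero-at-hang T gs leaves-solve )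
  , Separated⇒Solves T gs leaves-solve
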